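{- Let $G=(X,E)$ be a prefix graph. For any tiebreaking rule and any initial vertex $\tilde x\in X$, Algorithm G computes a genlex Hamilton path on $G$ starting at $\tilde x$.
   Context: A binary graph is a graph $G=(X,E)$ with $X\subseteq\{0,1\}^n$; $E(x)$ is the set of neighbors of $x$. For $b\in\{0,1\}$ let $X^b:=\{x\in X: x_n=b\}$, let $x^-$ denote $x$ with its last bit deleted, $X^{b- }:=\{x^-: x\in X^b\}$, and $G^{b- }:=(X^{b- },E^{b- })$ with $E^{b- }:=\{(x,y): x,y\in X^{b- },\ (xb,yb)\in E\}$ (here $xb$ is concatenation). $G$ is a prefix graph if $X=\emptyset$, or $n=0$ and $X=\{\varepsilon\}$ (the empty string), or $n>0$ and: (p1) $G^{0- }$ and $G^{1- }$ are prefix graphs, and (p2) if $X^0$ and $X^1$ are both nonempty, then for every $b\in\{0,1\}$ and every $x\in X^b$ there is $y\in X^{1-b}$ with $(x,y)\in E$. For distinct $x,y$ let $\lambda(x,y):=\max\{i: x_i\ne y_i\}$. An ordering of $X$ is genlex if for every $k$ all elements with the same suffix of length $k$ appear consecutively; a genlex Hamilton path is a Hamilton path whose vertex sequence is genlex. A tiebreaking rule is any rule selecting one element of a given nonempty set $N\subseteq X$ (possibly depending on the state of the algorithm). Algorithm G (input: $G$, initial vertex $\tilde x$, a tiebreaking rule): (G1) $x:=\tilde x$. (G2) Visit $x$. (G3) Let $N$ be the set of not yet visited neighbors $y\in E(x)$ minimizing $\lambda(x,y)$ among all not yet visited neighbors; terminate if $N=\emptyset$. (G4) Pick $y\in N$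 by the tiebreaking rule, set $x:=y$, go to (G2). -}

module Defs where

open import Data.Bool using (Bool; true; false; not)
import Data.Bool as B
open import Data.Nat using (ℕ; zero; suc; _∸_; _⊔_; _≤_)
open import Data.Fin as F using (Fin; toℕ)
open import Data.Vec using (Vec; []; _∷_; _∷ʳ_; last; lookup; toList)
open import Data.List as L using (List; []; _∷_; length; allFin; foldr; map; drop)
open import Data.List.Membership.Propositional using (_∈_; _∉_)
open import Data.List.Relation.Unary.All using (All)
open import Data.List.Relation.Unary.Unique.Propositional using (Unique)
open import Data.List.Relation.Unary.Linked using (Linked)
open import Data.Product using (_×_; ∃)
open import Data.Sum using (_⊎_)
open import Relation.Nullary using (¬_; does)
open import Relation.Binary.PropositionalEquality using (_≡_)

-- Bitstrings of length n; position i (1-based) is  lookup x (i-1),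
-- so x_n (the last bit) is  last x , and  x ∷ʳ b  is the concatenation xb.
Bits : ℕ → Set
Bits n = Vec Bool n

record IsBinaryGraph {n : ℕ} (X : Bits n → Set) (E : Bits n → Bits n → Set) : Set where
  field
    E⊆X×X : ∀ x y → E x y → X x × X y
    E-sym : ∀ x y → E x y → E y x
    E-irr : ∀ x → ¬ E x x

IsEmpty : {n : ℕ} → (Bits n → Set) → Set
IsEmpty X = ∀ x → ¬ X x

SubX : {n : ℕ} → (Bits (suc n) → Set) → Bool → Bits n → Set
SubX X b x = X (x ∷ʳ b)

SubE : {n : ℕ} → (Bits (suc n) → Set) → (Bits (suc n) → Bits (suc n) → Set)
     → Bool → Bits n → Bits n → Set
SubE X E b x y = X (x ∷ʳ b) × X (y ∷ʳ b) × E (x ∷ʳ b) (y ∷ʳ b)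

P2 : {n : ℕ} → (Bits (suc n) → Set) → (Bits (suc n) → Bits (suc n) → Set) → Set
P2 X E = (∃ λ x → X x × last x ≡ false) → (∃ λ x → X x × last x ≡ true) →
         ∀ (b : Bool) x → X x → last x ≡ b → ∃ λ y → X y × last y ≡ not b × E x y

IsPrefix : (n : ℕ) → (Bits n → Set) → (Bits n → Bits n → Set) → Set
IsPrefix zero    X E = IsEmpty X ⊎ X []   -- for n = 0, X = {ε} iff ε ∈ X
IsPrefix (suc n) X E =
  IsEmpty X ⊎
  ((IsPrefix n (SubX X false) (SubE X E false) ×
    IsPrefix n (SubX X true)  (SubE X E true)) × P2 X E)

-- λ(x,y) = max{ i : x_i ≠ y_i }  (1-based; 0 if no such i)
lam : {n : ℕ} → Bits n → Bits n → ℕ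
lam {n} x y = foldr _⊔_ 0
  (map (λ i → if does (lookup x i B.≟ lookup y i) then 0 else suc (toℕ i)) (allFin n))
  where open Data.Bool using (if_then_else_)

InN : {n : ℕ} → (Bits n → Bits n → Set) → List (Bits n) → Bits n → Bits n → Set
InN E visited x y =
  E x y × y ∉ visited × (∀ z → E x z → z ∉ visited → lam x y ≤ lam x z)

-- Continues E vis x out : with visited set vis
-- (containing the current vertex x), the algorithm, for SOME sequence of
-- tiebreaking choices, visits exactly the vertices  out  (in order) and then
-- terminates (N = ∅).
data Continues {n : ℕ} (E : Bits n → Bits n → Set) :
       List (Bits n) → Bits n → List (Bits n) → Set where
  stop : ∀ {vis x} → (∀ z → E x z → z ∈ vis) → Continues E vis x []
  step : ∀ {vis x y out} → InN E vis x y → Continues E (y ∷ vis) y out →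
         Continues E vis x (y ∷ out)

GOutput : {n : ℕ} → (Bits n → Bits n → Set) → Bits n → List (Bits n) → Set
GOutput E x̃ L = ∃ λ out → L ≡ x̃ ∷ out × Continues E (x̃ ∷ []) x̃ out

-- suffix of length k (for k ≥ n: the whole string)
suffix : {n : ℕ} → ℕ → Bits n → List Bool
suffix {n} k x = drop (n ∸ k) (toList x)

Genlex : {n : ℕ} → List (Bits n) → Set
Genlex Ls = ∀ (k : ℕ) (i j l : Fin (length Ls)) → toℕ i ≤ toℕ j → toℕ j ≤ toℕ l →
  suffix k (L.lookup Ls i) ≡ suffix k (L.lookup Ls l) →
  suffix k (L.lookup Ls j) ≡ suffix k (L.lookup Ls i)

HamiltonPath : {n : ℕ} → (Bits n → Set) → (Bits n → Bits n → Set) → List (Bits n) → Set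
HamiltonPath X E Ls = All X Ls × Unique Ls × (∀ x → X x → x ∈ Ls) × Linked E Ls

GenlexHamiltonPathFrom : {n : ℕ} → (Bits n → Set) → (Bits n → Bits n → Set) →
  Bits n → List (Bits n) → Set
GenlexHamiltonPathFrom X E x̃ Ls = HamiltonPath X E Ls × Genlex Ls × L.head Ls ≡ Data.Maybe.just x̃
  where import Data.Maybe

-- Write x ~d y when x and y agree in all positions > d, i.e. λ(x,y) ≤ d; the
-- classes of ~d are the blocks of vertices sharing a suffix of length n − d.
-- In a prefix graph one can always step from x towards any z ∈ X: if
-- λ(x,z) = d+1, some neighbour w of x has λ(w,z) ≤ d (descend into the
-- half-graphs G^{b−} while the last bits agree, and use (p2) at the highest
-- bit where x and z differ).  Hence every block containing the current vertex and
-- an unvisited vertex contains an unvisited neighbour of the current vertex,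
-- and as Algorithm G moves to an unvisited neighbour minimising λ it stays in
-- that block.  So the current vertex always lies in every block that contains
-- both a visited and an unvisited vertex.  This invariant makes the order
-- genlex, and at termination it forces every vertex to have been visited.
module Submission where

open import Defs
open import Data.Nat using (ℕ)
open import Data.List using (List)

open import Data.Bool using (Bool; true; false; not; _≟_; if_then_else_)
open import Data.Bool.Properties using (¬-not)
open import Data.Nat using (zero; suc; _∸_; _≤_; _<_; z≤n; s≤s; _<?_; _≤?_)
open import Data.Nat.Properties
  using (≤-refl; ≤-trans; ≤-reflexive; <⇒≤; ≰⇒>; ≮⇒≥; 1+n≰n; m+[n∸m]≡n; m⊔n≤o⇒m≤o; m⊔n≤o⇒n≤o; ⊔-lub)
open import Data.Fin using (Fin; toℕ)
import Data.Fin as Fin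
open import Data.Vec using (Vec; []; _∷_; _∷ʳ_; last; lookup; toList; initLast)
open import Data.Vec.Properties using (toList-∷ʳ; last-∷ʳ; length-toList; toList-injective; ≡-dec)
open import Data.Vec.Relation.Binary.Equality.Cast using (cast-is-id)
open import Data.List as L using ([]; _∷_; [_]; _++_; length; drop; allFin)
open import Data.List.Properties using (drop-drop; drop-all; ∷ʳ-injective; ∷-injectiveˡ; ∷-injectiveʳ; foldr-forcesᵇ; foldr-preservesᵇ)
open import Data.List.Membership.Propositional using (_∈_; _∉_)
open import Data.List.Membership.Propositional.Properties using (∈-lookup; ∈-allFin)
open import Data.List.Relation.Unary.All as All using (All; []; _∷_)
open import Data.List.Relation.Unary.All.Properties using (map⁺; map⁻; tabulate⁺)
open import Data.List.Relation.Unary.Any using (here; there)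
open import Data.List.Relation.Unary.AllPairs using ([]; _∷_)
open import Data.List.Relation.Unary.Unique.Propositional using (Unique)
open import Data.List.Relation.Unary.Linked using (Linked; [-]; _∷_)
open import Data.Product using (_×_; ∃; _,_; proj₁; proj₂)
open import Data.Sum using (_⊎_; inj₁; inj₂)
open import Data.Unit using (⊤; tt)
open import Data.Empty using (⊥-elim)
open import Relation.Nullary using (¬_; does; yes; no)
open import Relation.Binary.PropositionalEquality using (_≡_; ≢-sym; refl; sym; trans; cong; cong₂; subst; module ≡-Reasoning)

private
  variable
    A : Set
    n : ℕ

drop-toList-∷ʳ : ∀ d (a : A) (x : Vec A n) → d ≤ n →
                 drop d (toList (x ∷ʳ a)) ≡ drop d (toList x) ++ [ a ]
drop-toList-∷ʳ zero    a x       _         = toList-∷ʳ a x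
drop-toList-∷ʳ (suc d) a (b ∷ x) (s≤s d≤n) = drop-toList-∷ʳ d a x d≤n

drop-toList-≥ : ∀ d (x : Vec A n) → n ≤ d → drop d (toList x) ≡ []
drop-toList-≥ d x n≤d = drop-all d (toList x) (subst (_≤ d) (sym (length-toList x)) n≤d)

-- Agree d x y : x_i = y_i for all (1-based) i > d, that is λ(x,y) ≤ d.  The
-- record wrapper lets x and y be inferred from the type.
record Agree (d : ℕ) (x y : Bits n) : Set where
  constructor agree
  field agrees : drop d (toList x) ≡ drop d (toList y)
open Agree

Agree-refl : ∀ {d} {x : Bits n} → Agree d x x
Agree-refl = agree refl

Agree-sym : ∀ {d} {x y : Bits n} → Agree d x y → Agree d y x
Agree-sym (agree p) = agree (sym p)

Agree-trans : ∀ {d} {x y z : Bits n} → Agree d x y → Agree d y z → Agree d x z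
Agree-trans (agree p) (agree q) = agree (trans p q)

Agree-mono : ∀ {d d′} {x y : Bits n} → d ≤ d′ → Agree d x y → Agree d′ x y
Agree-mono {d = d} {d′} {x} {y} d≤d′ (agree p) = agree (begin
  drop d′ (toList x)                 ≡⟨ split x ⟩
  drop (d′ ∸ d) (drop d (toList x))  ≡⟨ cong (drop (d′ ∸ d)) p ⟩
  drop (d′ ∸ d) (drop d (toList y))  ≡⟨ split y ⟨
  drop d′ (toList y)                 ∎)
  where
  open ≡-Reasoning
  split : ∀ (v : Bits n) → drop d′ (toList v) ≡ drop (d′ ∸ d) (drop d (toList v))
  split v = trans (cong (λ k → drop k (toList v)) (sym (m+[n∸m]≡n d≤d′)))
                  (sym (drop-drop d (d′ ∸ d) (toList v)))

Agree-≥ : ∀ {d} (x y : Bits n) → n ≤ d → Agree d x y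
Agree-≥ {d = d} x y n≤d = agree (trans (drop-toList-≥ d x n≤d) (sym (drop-toList-≥ d y n≤d)))

Agree-zero⇒≡ : {x y : Bits n} → Agree 0 x y → x ≡ y
Agree-zero⇒≡ {x = x} {y} (agree p) = trans (sym (cast-is-id refl x)) (toList-injective refl x y p)

Agree-∷ʳ⁻ : ∀ {d} {x z : Bits n} {a c} → d ≤ n → Agree d (x ∷ʳ a) (z ∷ʳ c) → Agree d x z × a ≡ c
Agree-∷ʳ⁻ {d = d} {x} {z} {a} {c} d≤n (agree p)
  with q , a≡c ← ∷ʳ-injective (drop d (toList x)) (drop d (toList z))
                   (trans (sym (drop-toList-∷ʳ d a x d≤n)) (trans p (drop-toList-∷ʳ d c z d≤n)))
  = agree q , a≡c

Agree-∷ʳ⁺ : ∀ {d} {x z : Bits n} {a} → d ≤ n → Agree d x z → Agree d (x ∷ʳ a) (z ∷ʳ a)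
Agree-∷ʳ⁺ {d = d} {x} {z} {a} d≤n (agree p) =
  agree (trans (drop-toList-∷ʳ d a x d≤n) (trans (cong (_++ [ a ]) p) (sym (drop-toList-∷ʳ d a z d≤n))))

Agree-last : ∀ {x z : Bits n} {a c} → a ≡ c → Agree n (x ∷ʳ a) (z ∷ʳ c)
Agree-last {x = x} {z} refl = Agree-∷ʳ⁺ ≤-refl (Agree-≥ x z ≤-refl)

AgreeBits : ℕ → Bits n → Bits n → Set
AgreeBits {n} d x y = ∀ (i : Fin n) → d ≤ toℕ i → lookup x i ≡ lookup y i

AgreeBits⇒Agree : ∀ d (x y : Bits n) → AgreeBits d x y → Agree d x y
AgreeBits⇒Agree d x y eqs = agree (go d x y eqs)
  where
  go : ∀ {n} d (x y : Bits n) → AgreeBits d x y → drop d (toList x) ≡ drop d (toList y)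
  go d       []      []      _   = refl
  go zero    (a ∷ x) (b ∷ y) eqs = cong₂ _∷_ (eqs Fin.zero z≤n) (go zero x y (λ i _ → eqs (Fin.suc i) z≤n))
  go (suc d) (a ∷ x) (b ∷ y) eqs = go d x y (λ i d≤i → eqs (Fin.suc i) (s≤s d≤i))

Agree⇒AgreeBits : ∀ d (x y : Bits n) → Agree d x y → AgreeBits d x y
Agree⇒AgreeBits d x y (agree p) = go d x y p
  where
  go : ∀ {n} d (x y : Bits n) → drop d (toList x) ≡ drop d (toList y) → AgreeBits d x y
  go zero    (a ∷ x) (b ∷ y) p Fin.zero    _         = ∷-injectiveˡ p
  go zero    (a ∷ x) (b ∷ y) p (Fin.suc i) _         = go zero x y (∷-injectiveʳ p) i z≤n
  go (suc d) (a ∷ x) (b ∷ y) p (Fin.suc i) (s≤s d≤i) = go d x y p i d≤i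

mismatch : Bool → Bool → ℕ → ℕ
mismatch a b k = if does (a ≟ b) then 0 else suc k

mismatch≤⇒≡ : ∀ a b {k m} → mismatch a b k ≤ m → m ≤ k → a ≡ b
mismatch≤⇒≡ a b mis≤m m≤k with a ≟ b
... | yes a≡b = a≡b
... | no  _   = ⊥-elim (1+n≰n (≤-trans mis≤m m≤k))

≡⇒mismatch≤ : ∀ a b k m → (m ≤ k → a ≡ b) → mismatch a b k ≤ m
≡⇒mismatch≤ a b k m eq with a ≟ b | m ≤? k
... | yes _   | _       = z≤n
... | no  a≢b | yes m≤k = ⊥-elim (a≢b (eq m≤k))
... | no  _   | no  m≰k = ≰⇒> m≰k

lam≤⇒Agree : ∀ {d} {x y : Bits n} → lam x y ≤ d → Agree d x y
lam≤⇒Agree {n} {d} {x} {y} lam≤d = AgreeBits⇒Agree d x y λ i d≤i →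
  mismatch≤⇒≡ (lookup x i) (lookup y i) (All.lookup (map⁻ mismatches≤d) (∈-allFin i)) d≤i
  where
  mismatches≤d : All (_≤ d) (L.map (λ i → mismatch (lookup x i) (lookup y i) (toℕ i)) (allFin n))
  mismatches≤d = foldr-forcesᵇ {P = _≤ d} (λ a b a⊔b≤d → m⊔n≤o⇒m≤o a b a⊔b≤d , m⊔n≤o⇒n≤o a b a⊔b≤d) 0 _ lam≤d

Agree⇒lam≤ : ∀ {d} {x y : Bits n} → Agree d x y → lam x y ≤ d
Agree⇒lam≤ {n} {d} {x} {y} x~y = foldr-preservesᵇ {P = _≤ d} ⊔-lub z≤n (map⁺ (tabulate⁺ λ i →
  ≡⇒mismatch≤ (lookup x i) (lookup y i) (toℕ i) d (Agree⇒AgreeBits d x y x~y i)))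

both-halves-inhabited : ∀ (X : Bits (suc n) → Set) a {x z : Bits n} → X (x ∷ʳ a) → X (z ∷ʳ not a) →
  (∃ λ u → X u × last u ≡ false) × (∃ λ u → X u × last u ≡ true)
both-halves-inhabited X false {x} {z} Xx Xz = (_ , Xx , last-∷ʳ false x) , (_ , Xz , last-∷ʳ true z)
both-halves-inhabited X true  {x} {z} Xx Xz = (_ , Xz , last-∷ʳ false z) , (_ , Xx , last-∷ʳ true x)

half-prefix : ∀ (X : Bits (suc n) → Set) E →
  IsPrefix n (SubX X false) (SubE X E false) → IsPrefix n (SubX X true) (SubE X E true) →
  ∀ b → IsPrefix n (SubX X b) (SubE X E b)
half-prefix X E p₀ p₁ false = p₀
half-prefix X E p₀ p₁ true  = p₁

prefix-step-toward : ∀ n (X : Bits n → Set) E → IsPrefix n X E →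
  ∀ {x z} d → X x → X z → Agree (suc d) x z → ¬ Agree d x z →
  ∃ λ w → X w × E x w × Agree d w z
prefix-step-toward zero    X E _             {[]} {[]} d _ _ _ x≁z = ⊥-elim (x≁z Agree-refl)
prefix-step-toward (suc m) X E (inj₁ empty)  {x}       d Xx _ _ _ = ⊥-elim (empty x Xx)
prefix-step-toward (suc m) X E (inj₂ ((p₀ , p₁) , p₂)) {x} {z} d Xx Xz x~z x≁z
  with x′ , a , refl ← initLast x | z′ , c , refl ← initLast z | d <? m
... | yes d<m
  with x′~z′ , refl ← Agree-∷ʳ⁻ d<m x~z
  with w′ , Xw , (_ , _ , Exw) , w′~z′ ←
         prefix-step-toward m (SubX X a) (SubE X E a) (half-prefix X E p₀ p₁ a) d Xx Xz x′~z′
           (λ x′~z′ → x≁z (Agree-∷ʳ⁺ (<⇒≤ d<m) x′~z′))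
  = w′ ∷ʳ a , Xw , Exw , Agree-∷ʳ⁺ (<⇒≤ d<m) w′~z′
... | no d≮m with a ≟ c
...   | yes a≡c = ⊥-elim (x≁z (Agree-mono (≮⇒≥ d≮m) (Agree-last a≡c)))
...   | no  a≢c
  with refl ← ¬-not (≢-sym a≢c)
  with halves ← both-halves-inhabited X a Xx Xz
  with y , Xy , last-y , Exy ← p₂ (proj₁ halves) (proj₂ halves) a (x′ ∷ʳ a) Xx (last-∷ʳ a x′)
  with y′ , b , refl ← initLast y
  -- matching on initLast y has turned last-y into b ≡ not a
  = y′ ∷ʳ b , Xy , Exy , Agree-mono (≮⇒≥ d≮m) (Agree-last last-y)

prefix-step-decreasing-lam : ∀ {X : Bits n → Set} {E} → IsPrefix n X E → ∀ {x z e} → X x → X z →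
  lam x z ≡ suc e → ∃ λ w → X w × E x w × Agree e w z
prefix-step-decreasing-lam {n} {X} {E} prefix {e = e} Xx Xz lam≡ =
  prefix-step-toward n X E prefix e Xx Xz (lam≤⇒Agree (≤-reflexive lam≡))
    (λ x~z → 1+n≰n (subst (_≤ e) lam≡ (Agree⇒lam≤ x~z)))

-- seen holds the elements preceding xs, in reverse order.
Consecutive : (A → A → Set) → List A → List A → Set
Consecutive R seen []       = ⊤
Consecutive R seen (x ∷ xs) =
  (∀ {u z} → u ∈ seen → z ∈ xs → R u z → R x u) × Consecutive R (x ∷ seen) xs

module _ {R : A → A → Set} (R-refl : ∀ {x} → R x x) (R-sym : ∀ {x y} → R x y → R y x) where

  consecutive-after-seen : ∀ {seen} xs → Consecutive R seen xs → ∀ {u} (j l : Fin (length xs)) →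
    u ∈ seen → toℕ j ≤ toℕ l → R u (L.lookup xs l) → R (L.lookup xs j) u
  consecutive-after-seen (x ∷ xs) _            Fin.zero    Fin.zero    _   _         u~x = R-sym u~x
  consecutive-after-seen (x ∷ xs) (between , _) Fin.zero    (Fin.suc l) u∈  _         u~z =
    between u∈ (∈-lookup l) u~z
  consecutive-after-seen (x ∷ xs) (_ , rest)   (Fin.suc j) (Fin.suc l) u∈ (s≤s j≤l) u~z =
    consecutive-after-seen xs rest j l (there u∈) j≤l u~z

  consecutive-lookup : ∀ {seen} xs → Consecutive R seen xs → (i j l : Fin (length xs)) →
    toℕ i ≤ toℕ j → toℕ j ≤ toℕ l → R (L.lookup xs i) (L.lookup xs l) → R (L.lookup xs j) (L.lookup xs i)
  consecutive-lookup (x ∷ xs) _          Fin.zero    Fin.zero    l           _         _         _   = R-refl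
  consecutive-lookup (x ∷ xs) (_ , rest) Fin.zero    (Fin.suc j) (Fin.suc l) _         (s≤s j≤l) x~z =
    consecutive-after-seen xs rest j l (here refl) j≤l x~z
  consecutive-lookup (x ∷ xs) (_ , rest) (Fin.suc i) (Fin.suc j) (Fin.suc l) (s≤s i≤j) (s≤s j≤l) u~z =
    consecutive-lookup xs rest i j l i≤j j≤l u~z

Consecutive⇒Genlex : (Ls : List (Bits n)) → (∀ d → Consecutive (Agree d) [] Ls) → Genlex Ls
Consecutive⇒Genlex {n} Ls consecutive k i j l i≤j j≤l same =
  agrees (consecutive-lookup Agree-refl Agree-sym Ls (consecutive (n ∸ k)) i j l i≤j j≤l (agree same))

module AlgorithmG (X : Bits n → Set) (E : Bits n → Bits n → Set)
                  (binary : IsBinaryGraph X E) (prefix : IsPrefix n X E) where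
  open IsBinaryGraph binary
  open import Data.List.Membership.DecPropositional (≡-dec {n = n} _≟_) using (_∈?_)

  record Invariant (visited : List (Bits n)) (x : Bits n) : Set where
    field
      current-visited : x ∈ visited
      current-in-X    : X x
      in-open-blocks  : ∀ {d u z} → u ∈ visited → X z → z ∉ visited → Agree d u z → Agree d x u
  open Invariant

  unvisited-neighbour : ∀ {visited x z d} → Invariant visited x → X z → z ∉ visited → Agree d x z →
    ∃ λ w → E x w × w ∉ visited × Agree d x w
  unvisited-neighbour {visited} {x} {z} {d} inv Xz z∉ x~z with lam x z in lam≡
  ... | zero = ⊥-elim (z∉ (subst (_∈ visited) (Agree-zero⇒≡ (lam≤⇒Agree (≤-reflexive lam≡))) (current-visited inv)))
  ... | suc e
    with w , _ , Exw , w~z ← prefix-step-decreasing-lam prefix (current-in-X inv) Xz lam≡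
    = w , Exw , w∉ , Agree-trans x~z (Agree-sym (Agree-mono (<⇒≤ e<d) w~z))
    where
    w∉ : w ∉ visited
    w∉ w∈ = 1+n≰n (subst (_≤ e) lam≡ (Agree⇒lam≤ (Agree-trans (in-open-blocks inv w∈ Xz z∉ w~z) w~z)))
    e<d : e < d
    e<d = subst (_≤ d) lam≡ (Agree⇒lam≤ x~z)

  -- A block of x that still has unvisited vertices contains an unvisited
  -- neighbour w of x, so the chosen y has λ(x,y) ≤ λ(x,w) and lies in it too.
  Invariant-step : ∀ {visited x y} → Invariant visited x → InN E visited x y → Invariant (y ∷ visited) y
  Invariant-step {visited} {x} {y} inv (Exy , y∉ , minimal) = record
    { current-visited = here refl
    ; current-in-X    = proj₂ (E⊆X×X x y Exy)
    ; in-open-blocks  = open-blocks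
    }
    where
    open-blocks : ∀ {d u z} → u ∈ y ∷ visited → X z → z ∉ y ∷ visited → Agree d u z → Agree d y u
    open-blocks (here refl) _  _  _   = Agree-refl
    open-blocks {d} {u} {z} (there u∈) Xz z∉ u~z = Agree-trans (Agree-sym x~y) x~u
      where
      z∉′ : z ∉ visited
      z∉′ z∈ = z∉ (there z∈)
      x~u : Agree d x u
      x~u = in-open-blocks inv u∈ Xz z∉′ u~z
      x~y : Agree d x y
      x~y with w , Exw , w∉ , x~w ← unvisited-neighbour inv Xz z∉′ (Agree-trans x~u u~z)
        = lam≤⇒Agree (≤-trans (minimal w Exw w∉) (Agree⇒lam≤ x~w))

  Invariant-start : ∀ {x} → X x → Invariant (x ∷ []) x
  Invariant-start Xx = record
    { current-visited = here refl
    ; current-in-X    = Xx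
    ; in-open-blocks  = λ { (here refl) _ _ _ → Agree-refl }
    }

  run-unvisited : ∀ {visited x out} → Continues E visited x out → All (_∉ visited) out
  run-unvisited (stop _)                 = []
  run-unvisited (step (_ , y∉ , _) rest) = y∉ ∷ All.map (λ z∉ z∈ → z∉ (there z∈)) (run-unvisited rest)

  run-unique : ∀ {visited x out} → x ∈ visited → Continues E visited x out → Unique (x ∷ out)
  run-unique x∈ (stop _)      = [] ∷ []
  run-unique x∈ run@(step _ rest) =
    All.map (λ z∉ x≡z → z∉ (subst (_∈ _) x≡z x∈)) (run-unvisited run) ∷ run-unique (here refl) rest

  run-in-X : ∀ {visited x out} → X x → Continues E visited x out → All X out
  run-in-X Xx (stop _)               = []
  run-in-X {x = x} Xx (step {y = y} (Exy , _) rest) = Xy ∷ run-in-X Xy rest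
    where
    Xy : X y
    Xy = proj₂ (E⊆X×X x y Exy)

  run-linked : ∀ {visited x out} → Continues E visited x out → Linked E (x ∷ out)
  run-linked (stop _)             = [-]
  run-linked (step (Exy , _) rest) = Exy ∷ run-linked rest

  run-consecutive : ∀ {visited x out} d → Invariant visited x → Continues E visited x out →
    Consecutive (Agree d) visited out
  run-consecutive d inv (stop _)        = tt
  run-consecutive {visited} d inv (step {y = y} y∈N rest) =
    (λ u∈ z∈ u~z → in-open-blocks inv′ (there u∈) (All.lookup (run-in-X (current-in-X inv′) rest) z∈)
                     (All.lookup (run-unvisited rest) z∈) u~z)
    , run-consecutive d inv′ rest
    where
    inv′ : Invariant (y ∷ visited) y
    inv′ = Invariant-step inv y∈N

  run-covers : ∀ {visited x out z} → Invariant visited x → Continues E visited x out → X z →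
    z ∈ visited ⊎ z ∈ out
  run-covers {visited} {x} {z = z} inv (stop no-unvisited) Xz with z ∈? visited
  ... | yes z∈ = inj₁ z∈
  ... | no  z∉ with w , Exw , w∉ , _ ← unvisited-neighbour inv Xz z∉ (Agree-≥ x z ≤-refl)
                 = ⊥-elim (w∉ (no-unvisited w Exw))
  run-covers inv (step y∈N rest) Xz with run-covers (Invariant-step inv y∈N) rest Xz
  ... | inj₁ (here z≡y) = inj₂ (here z≡y)
  ... | inj₁ (there z∈) = inj₁ z∈
  ... | inj₂ z∈         = inj₂ (there z∈)

theorem9 : (n : ℕ) (X : Bits n → Set) (E : Bits n → Bits n → Set) →
    IsBinaryGraph X E → IsPrefix n X E →
    (x̃ : Bits n) → X x̃ →
    (Ls : List (Bits n)) → GOutput E x̃ Ls →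
    GenlexHamiltonPathFrom X E x̃ Ls
theorem9 n X E binary prefix x̃ Xx̃ .(x̃ ∷ out) (out , refl , run) =
  (Xx̃ ∷ run-in-X Xx̃ run , run-unique (here refl) run , covers , run-linked run) ,
  Consecutive⇒Genlex (x̃ ∷ out) (λ d → (λ ()) , run-consecutive d start run) ,
  refl
  where
  open AlgorithmG X E binary prefix
  start : Invariant (x̃ ∷ []) x̃
  start = Invariant-start Xx̃
  covers : ∀ z → X z → z ∈ x̃ ∷ out
  covers z Xz with run-covers start run Xz
  ... | inj₁ (here z≡x̃) = here z≡x̃
  ... | inj₂ z∈         = there z∈
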